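{- Let $x_1,\dots,x_n$ be elements with real values, compared by an imprecise comparator (model in context). Perform a round-robin tournament, i.e. compare every pair of distinct elements exactly once, and order the elements by their number of wins (elements with more wins placed higher; ties broken arbitrarily). Then the resulting order is sorted with error $2$: whenever $x_a$ is placed higher than $x_b$, $\mathrm{val}(x_a)\ge \mathrm{val}(x_b)-2$.
   Context: Model: each element $x_i$ has an unknown real value $\mathrm{val}(x_i)$. An algorithm may query the comparator on a pair $x_i,x_j$; it answers either "$x_i\ge x_j$" or "$x_j\ge x_i$". If $|\mathrm{val}(x_i)-\mathrm{val}(x_j)|>1$ the answer is correct; otherwise the answer is arbitrary (possibly adversarial and adaptive). (The imprecision threshold is normalized to $1$.) We say $x$ defeats $y$ (and $y$ loses to $x$) if the comparator answered "$x\ge y$".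
   Formalization: The element values $\mathrm{val}(x_i)$ are taken to be rational rather than real. -}

module Defs where

open import Data.Nat using (ℕ)
open import Data.Bool using (Bool; true; false; not)
open import Data.Fin using (Fin)
open import Data.Fin.Properties using (_≟_)
open import Data.List using (List; length; filter)
open import Data.List.Base using (allFin)
open import Data.Rational using (ℚ; _+_; _-_; _<_; _≤_; 1ℚ)
open import Relation.Binary.PropositionalEquality using (_≡_)
open import Relation.Nullary using (¬_; _×-dec_; ¬?)
open import Data.Bool.Properties using (T?)
open import Data.Bool using (T)
open import Data.Product using (_×_)
open import Data.Fin.Permutation using (Permutation′; _⟨$⟩ʳ_)

-- Outcome of a round-robin tournament on n elements:
-- beats i j ≡ true  means the comparator answered "x_i ≥ x_j" (x_i defeats x_j).
-- Only entries with i ≢ j are meaningful (the diagonal is ignored).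
Outcome : ℕ → Set
Outcome n = Fin n → Fin n → Bool

IsTournament : {n : ℕ} → Outcome n → Set
IsTournament {n} beats = (i j : Fin n) → ¬ (i ≡ j) → beats i j ≡ not (beats j i)

Consistent : {n : ℕ} → (Fin n → ℚ) → Outcome n → Set
Consistent {n} val beats = (i j : Fin n) → val j + 1ℚ < val i → beats i j ≡ true

wins : {n : ℕ} → Outcome n → Fin n → ℕ
wins {n} beats i = length (filter (λ j → ¬? (i ≟ j) ×-dec T? (beats i j)) (allFin n))

-- A placement of the elements: pos i is the position of x_i (position 0 = highest).
-- It orders by number of wins if more wins implies a strictly higher place
-- (ties are broken arbitrarily, i.e. any such placement is allowed).
OrdersByWins : {n : ℕ} → Outcome n → Permutation′ n → Set
OrdersByWins {n} beats pos =
  (i j : Fin n) → wins beats j Data.Nat.< wins beats i →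
  (pos ⟨$⟩ʳ i) Data.Fin.< (pos ⟨$⟩ʳ j)

{-# OPTIONS --safe #-}
module Submission where

-- If val a < val b - 2 then b defeats a, and every j that a defeats has
-- val j ≤ val a + 1 < val b - 1, so b defeats j as well. Thus the elements
-- a defeats form a subset of those b defeats which misses a itself: a has
-- strictly fewer wins than b and cannot be placed above it.

open import Defs
open import Data.Nat using (ℕ)
open import Data.Fin using (Fin; _<_)
open import Data.Rational using (ℚ; _+_; _-_; _≤_; 1ℚ)
open import Data.Fin.Permutation using (Permutation′; _⟨$⟩ʳ_)

import Data.Nat as ℕ
import Data.Nat.Properties as ℕ
import Data.Fin.Properties as Fin
import Data.Rational as ℚ
import Data.Rational.Properties as ℚ
open import Data.Rational.Solver using (module +-*-Solver)
open import Data.Bool using (true; T)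
open import Data.Bool.Properties using (T?; T-≡)
open import Data.Product using (_×_; _,_; proj₂)
open import Data.List using (List; length; filter; allFin)
open import Data.List.Membership.Propositional using (_∈_; _∉_)
open import Data.List.Membership.Propositional.Properties using (∈-allFin; ∈-filter⁺; ∈-filter⁻)
open import Data.List.Relation.Binary.Pointwise using (Pointwise-≡⇒≡)
open import Data.List.Relation.Binary.Sublist.Propositional using (_⊆_; ⊆-refl)
open import Data.List.Relation.Binary.Sublist.Heterogeneous.Properties using (length-mono-≤; toPointwise; ⊆-filter-Sublist)
open import Function using (Equivalence; _∘_)
open import Relation.Nullary using (¬_; ¬?; _×-dec_)
open import Relation.Unary using (Pred; Decidable)
open import Relation.Binary.PropositionalEquality using (_≡_; _≢_; refl; sym; subst)

module _ {a} {A : Set a} where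

  ⊆-length-< : {xs ys : List A} {y : A} → xs ⊆ ys → y ∈ ys → y ∉ xs → length xs ℕ.< length ys
  ⊆-length-< xs⊆ys y∈ys y∉xs = ℕ.≤∧≢⇒< (length-mono-≤ xs⊆ys) λ |xs|≡|ys| →
    y∉xs (subst (_ ∈_) (sym (Pointwise-≡⇒≡ (toPointwise |xs|≡|ys| xs⊆ys))) y∈ys)

  filter-length-< : ∀ {p q} {P : Pred A p} {Q : Pred A q} (P? : Decidable P) (Q? : Decidable Q) →
    (∀ {x} → P x → Q x) → (xs : List A) {y : A} → y ∈ xs → ¬ P y → Q y →
    length (filter P? xs) ℕ.< length (filter Q? xs)
  filter-length-< P? Q? P⇒Q xs y∈xs ¬Py Qy = ⊆-length-< filterP⊆filterQ
    (∈-filter⁺ Q? y∈xs Qy) (λ y∈filterP → ¬Py (proj₂ (∈-filter⁻ P? {xs = xs} y∈filterP)))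
    where
    filterP⊆filterQ : filter P? xs ⊆ filter Q? xs
    filterP⊆filterQ = ⊆-filter-Sublist P? Q? (λ { refl → P⇒Q }) (⊆-refl {x = xs})

p≤p+1 : ∀ p → p ≤ p + 1ℚ
p≤p+1 p = subst (_≤ p + 1ℚ) (ℚ.+-identityʳ p) (ℚ.+-monoʳ-≤ p (ℚ.nonNegative⁻¹ 1ℚ))

y≤x+1⇒x<z-2⇒y+1<z : ∀ {x y z} → y ≤ x + 1ℚ → x ℚ.< z - (1ℚ + 1ℚ) → y + 1ℚ ℚ.< z
y≤x+1⇒x<z-2⇒y+1<z {y = y} {z} y≤x+1 x<z-2 = subst (y + 1ℚ ℚ.<_) z-2+1+1≡z
  (ℚ.≤-<-trans (ℚ.+-monoˡ-≤ 1ℚ y≤x+1) (ℚ.+-monoˡ-< 1ℚ (ℚ.+-monoˡ-< 1ℚ x<z-2)))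
  where
  open +-*-Solver
  z-2+1+1≡z : z - (1ℚ + 1ℚ) + 1ℚ + 1ℚ ≡ z
  z-2+1+1≡z = solve 1 (λ z → z :- (con 1ℚ :+ con 1ℚ) :+ con 1ℚ :+ con 1ℚ := z) refl z

Defeats : {n : ℕ} → Outcome n → Fin n → Fin n → Set
Defeats beats i j = i ≢ j × T (beats i j)

defeats? : {n : ℕ} (beats : Outcome n) (i : Fin n) → Decidable (Defeats beats i)
defeats? beats i j = ¬? (i Fin.≟ j) ×-dec T? (beats i j)

module _ {n : ℕ} {beats : Outcome n} (tournament : IsTournament beats) where

  beaten⇒¬beats : ∀ {i j} → i ≢ j → beats j i ≡ true → ¬ T (beats i j)
  beaten⇒¬beats {i} {j} i≢j j▷i rewrite tournament i j i≢j | j▷i = λ ()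

  module _ {val : Fin n → ℚ} (consistent : Consistent val beats) where

    defeated-≤+1 : ∀ {i j} → Defeats beats i j → val j ≤ val i + 1ℚ
    defeated-≤+1 {i} {j} (i≢j , i▷j) =
      ℚ.≮⇒≥ λ i+1<j → beaten⇒¬beats i≢j (consistent j i i+1<j) i▷j

    wins-< : ∀ {a b} → val a ℚ.< val b - (1ℚ + 1ℚ) → wins beats a ℕ.< wins beats b
    wins-< {a} {b} a<b-2 = filter-length-< (defeats? beats a) (defeats? beats b)
      a▷j⇒b▷j (allFin n) (∈-allFin a) (λ (a≢a , _) → a≢a refl) (b≢a , Equivalence.from T-≡ b▷a)
      where
      a+1<b : val a + 1ℚ ℚ.< val b
      a+1<b = y≤x+1⇒x<z-2⇒y+1<z (p≤p+1 (val a)) a<b-2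
      b▷a : beats b a ≡ true
      b▷a = consistent b a a+1<b
      a≢b : a ≢ b
      a≢b refl = ℚ.<-irrefl refl (ℚ.≤-<-trans (p≤p+1 (val a)) a+1<b)
      b≢a : b ≢ a
      b≢a = a≢b ∘ sym
      a▷j⇒b▷j : ∀ {j} → Defeats beats a j → Defeats beats b j
      a▷j⇒b▷j {j} a▷j@(_ , Ta▷j) = b≢j , Equivalence.from T-≡ b▷j
        where
        b▷j : beats b j ≡ true
        b▷j = consistent b j (y≤x+1⇒x<z-2⇒y+1<z (defeated-≤+1 a▷j) a<b-2)
        b≢j : b ≢ j
        b≢j refl = beaten⇒¬beats a≢b b▷a Ta▷j

theorem1 : (n : ℕ) (val : Fin n → ℚ) (beats : Outcome n) →
    IsTournament beats → Consistent val beats →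
    (pos : Permutation′ n) → OrdersByWins beats pos →
    (a b : Fin n) → (pos ⟨$⟩ʳ a) < (pos ⟨$⟩ʳ b) →
    val b - (1ℚ + 1ℚ) ≤ val a
theorem1 n val beats tournament consistent pos ordersByWins a b a-above-b =
  ℚ.≮⇒≥ λ a<b-2 → Fin.<-asym a-above-b (ordersByWins b a (wins-< tournament consistent a<b-2))
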